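{- Let $G,H$ be simple graphs, $u_1\in V(G)$, $v_1\in V(H)$, and $k$ a positive integer. Then $$A_k^{G\times H}((u_1,v_1)) = k!\,A_k^G(u_1)\,A_k^H(v_1).$$
   Context: For a graph $F$ and vertex $w$, $N(w)$ denotes the set of vertices adjacent to $w$ (so $w\notin N(w)$), and $A_k^F(w)$ denotes the number of $k$-cliques (sets of $k$ pairwise adjacent vertices) contained in $N(w)$. The tensor product $G\times H$ of graphs $G=(V_1,E_1)$, $H=(V_2,E_2)$ has vertex set $V_1\times V_2$, with $(v_1,v_2)$ adjacent to $(v_1',v_2')$ if and only if $v_1v_1'\in E_1$ and $v_2v_2'\in E_2$. -}

module Defs where

open import Data.Nat.Base using (ℕ; zero; suc; _*_; _≡ᵇ_)
open import Data.Bool.Base using (Bool; true; false; _∧_; _∨_; not; if_then_else_)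
open import Data.Fin.Base using (Fin; quotient; remainder; combine)
open import Data.Fin.Properties using (_≟_)
open import Data.Fin.Subset using (Subset; ∣_∣; inside; outside)
open import Data.Vec.Base using (_∷_; []; lookup)
open import Data.List.Base using (List; []; _∷_; map; _++_; filter; length; allFin; foldr)
open import Relation.Nullary.Decidable using (does)
open import Relation.Binary.PropositionalEquality using (_≡_; refl; cong₂)
open import Function.Base using (_∘_)
open import Relation.Unary using (Pred)
open import Data.Bool using (T?)

record Graph (n : ℕ) : Set where
  field
    adj    : Fin n → Fin n → Bool
    sym    : ∀ x y → adj x y ≡ adj y x
    irrefl : ∀ x → adj x x ≡ false
open Graph public

all : ∀ {a} {A : Set a} → (A → Bool) → List A → Bool
all p = foldr (λ x b → p x ∧ b) true

allSubsets : (n : ℕ) → List (Subset n)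
allSubsets zero    = [] ∷ []
allSubsets (suc n) = map (inside ∷_) (allSubsets n) ++ map (outside ∷_) (allSubsets n)

_⇒ᵇ_ : Bool → Bool → Bool
a ⇒ᵇ b = not a ∨ b

inNbhd : ∀ {n} → Graph n → Fin n → Subset n → Bool
inNbhd {n} G w S = all (λ i → lookup S i ⇒ᵇ adj G w i) (allFin n)

isClique : ∀ {n} → Graph n → Subset n → Bool
isClique {n} G S =
  all (λ i → all (λ j → (lookup S i ∧ lookup S j ∧ not (does (i ≟ j))) ⇒ᵇ adj G i j)
                 (allFin n))
      (allFin n)

A : ∀ {n} → ℕ → Graph n → Fin n → ℕ
A {n} k G w =
  length (filter (λ S → T? ((∣ S ∣ ≡ᵇ k) ∧ inNbhd G w S ∧ isClique G S)) (allSubsets n))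

-- Tensor product G × H, with vertex set Fin (n * m) ≅ Fin n × Fin m
-- via combine / (quotient, remainder).
tensorAdj : ∀ {n m} → Graph n → Graph m → Fin (n * m) → Fin (n * m) → Bool
tensorAdj {n} {m} G H x y =
  adj G (quotient m x) (quotient m y) ∧ adj H (remainder {n} m x) (remainder {n} m y)


tensor : ∀ {n m} → Graph n → Graph m → Graph (n * m)
tensor {n} {m} G H = record
  { adj    = tensorAdj G H
  ; sym    = λ x y → cong₂ _∧_ (sym G (quotient m x) (quotient m y))
                                 (sym H (remainder {n} m x) (remainder {n} m y))
  ; irrefl = λ x → irr (adj G (quotient m x) (quotient m x))
                        (adj H (remainder {n} m x) (remainder {n} m x))
                        (irrefl G (quotient m x))
  }
  where
  irr : ∀ a b → a ≡ false → (a ∧ b) ≡ false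
  irr .false b refl = refl

pair : ∀ {n m} → Fin n → Fin m → Fin (n * m)
pair = combine

module Submission where

open import Defs hiding (sym)
open import Data.Nat.Base using (ℕ; zero; suc; _+_; _*_; _!; _≡ᵇ_)
open import Data.Nat.Properties
  using (+-*-semiring; +-commutativeSemigroup; +-identityʳ; +-assoc; *-zeroʳ; suc-injective;
         ≡ᵇ⇒≡; ≡⇒≡ᵇ)
open import Data.Nat.Tactic.RingSolver using (solve-∀)
open import Data.Fin.Base using (Fin; zero; suc; _↑ˡ_; _↑ʳ_; quotient; remainder; remQuot)
open import Data.Fin.Properties using (_≟_; remQuot-combine; splitAt-↑ʳ)
import Data.Fin.Properties as Fin
open import Data.Fin.Subset using (Subset; ∣_∣; inside; outside)
open import Data.Vec.Base using (_∷_; lookup)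
open import Data.List.Base using (List; []; _∷_; map; _++_; filter; length; allFin; tabulate)
open import Data.Bool.Base using (Bool; true; false; _∧_; not; T)
open import Data.Bool using (T?)
open import Data.Bool.Properties using (∧-zeroʳ; ∧-commutativeMonoid; T-∧)
open import Data.Product using (_×_; _,_; proj₁; proj₂)
open import Data.Product.Function.NonDependent.Propositional using (_×-⇔_)
open import Data.Unit using (tt)
open import Function.Base using (_∘_; _on_)
open import Function.Bundles using (_⇔_; mk⇔; Equivalence)
open import Function.Construct.Composition using (_⇔-∘_)
open import Function.Construct.Identity using (⇔-id)
open import Function.Construct.Symmetry using (⇔-sym)
open import Relation.Nullary using (does; yes; no; contradiction)
open import Relation.Binary.PropositionalEquality
  using (_≡_; _≢_; _≗_; refl; sym; trans; cong; cong₂; subst; module ≡-Reasoning)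
open import Algebra.Bundles using (CommutativeMonoid)
open import Algebra.Properties.Semiring.Sum +-*-semiring
  using (sum; sum-syntax; sum-cong-≗; ∑-distrib-+; *-distribˡ-sum)
open import Algebra.Properties.CommutativeSemigroup +-commutativeSemigroup using (x∙yz≈y∙xz)
import Algebra.Properties.CommutativeSemigroup
  (CommutativeMonoid.commutativeSemigroup ∧-commutativeMonoid) as ∧

-- For vertex sets P of G and Q of H, the number c_k of k-cliques satisfies
-- c_k(P × Q) = k! c_k(P) c_k(Q) in G × H; we prove this by induction on |V(G)|.  The
-- block {u₀} × V(H) of a vertex u₀ of G is independent because G has no loops, so a
-- (k+1)-clique meets it at most once.  Cliques avoiding it are cliques of (G - u₀) × H;
-- a clique through (u₀, y) is that vertex together with a k-clique of
-- (P ∩ N(u₀)) × (Q ∩ N(y)) in (G - u₀) × H, and summing c_k(Q ∩ N(y)) over y ∈ Q counts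
-- each (k+1)-clique of Q once per vertex, giving (k+1) c_{k+1}(Q).  The theorem is the
-- case P = N(u₁), Q = N(v₁), whose product is the neighbourhood of (u₁, v₁).

BoolPred : ℕ → Set
BoolPred n = Fin n → Bool

BoolRel : ℕ → Set
BoolRel n = Fin n → Fin n → Bool

Symmetricᵇ : ∀ {n} → BoolRel n → Set
Symmetricᵇ R = ∀ i j → R i j ≡ R j i

Irreflexiveᵇ : ∀ {n} → BoolRel n → Set
Irreflexiveᵇ R = ∀ i → R i i ≡ false

Symmetricᵇ-on : ∀ {n m} (R : BoolRel n) (f : Fin m → Fin n) → Symmetricᵇ R → Symmetricᵇ (R on f)
Symmetricᵇ-on R f sym-R i j = sym-R (f i) (f j)

Irreflexiveᵇ-on : ∀ {n m} (R : BoolRel n) (f : Fin m → Fin n) → Irreflexiveᵇ R → Irreflexiveᵇ (R on f)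
Irreflexiveᵇ-on R f irr-R = irr-R ∘ f

infixr 6 _∩_
_∩_ : ∀ {n} → BoolPred n → BoolPred n → BoolPred n
(p ∩ q) i = p i ∧ q i

⟦_⟧ : Bool → ℕ
⟦ true  ⟧ = 1
⟦ false ⟧ = 0

⟦∧⟧ : ∀ a b → ⟦ a ∧ b ⟧ ≡ ⟦ a ⟧ * ⟦ b ⟧
⟦∧⟧ true  true  = refl
⟦∧⟧ true  false = refl
⟦∧⟧ false b     = refl

-- The number of k-cliques of R contained in p.
cliques : ∀ n → BoolPred n → BoolRel n → ℕ → ℕ
cliques n       p R zero    = 1
cliques zero    p R (suc k) = 0
cliques (suc n) p R (suc k) =
  ⟦ p zero ⟧ * cliques n ((p ∩ R zero) ∘ suc) (R on suc) k + cliques n (p ∘ suc) (R on suc) (suc k)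

cliques-cong : ∀ n {p p′ : BoolPred n} {R R′ : BoolRel n} →
  p ≗ p′ → (∀ i j → R i j ≡ R′ i j) → ∀ k → cliques n p R k ≡ cliques n p′ R′ k
cliques-cong n       p≗p′ R≗R′ zero    = refl
cliques-cong zero    p≗p′ R≗R′ (suc k) = refl
cliques-cong (suc n) p≗p′ R≗R′ (suc k) =
  cong₂ _+_
    (cong₂ _*_ (cong ⟦_⟧ (p≗p′ zero))
               (cliques-cong n (λ i → cong₂ _∧_ (p≗p′ (suc i)) (R≗R′ zero (suc i)))
                               (λ i j → R≗R′ (suc i) (suc j)) k))
    (cliques-cong n (p≗p′ ∘ suc) (λ i j → R≗R′ (suc i) (suc j)) (suc k))

cliques-drop-zero : ∀ n (p : BoolPred (suc n)) R → p zero ≡ false →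
  ∀ k → cliques (suc n) p R k ≡ cliques n (p ∘ suc) (R on suc) k
cliques-drop-zero n p R p₀≡false zero    = refl
cliques-drop-zero n p R p₀≡false (suc k) rewrite p₀≡false = refl

cliques-drop-↑ˡ : ∀ m N (P : BoolPred (m + N)) R → (∀ y → P (y ↑ˡ N) ≡ false) →
  ∀ k → cliques (m + N) P R k ≡ cliques N (P ∘ (m ↑ʳ_)) (R on (m ↑ʳ_)) k
cliques-drop-↑ˡ zero    N P R P↑ˡ≡false k = refl
cliques-drop-↑ˡ (suc m) N P R P↑ˡ≡false k =
  trans (cliques-drop-zero (m + N) P R (P↑ˡ≡false zero) k)
        (cliques-drop-↑ˡ m N (P ∘ suc) (R on suc) (P↑ˡ≡false ∘ suc) k)

-- A clique meets an independent set in at most one vertex.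
cliques-independent-↑ˡ : ∀ m N (P : BoolPred (m + N)) R →
  (∀ y y′ → R (y ↑ˡ N) (y′ ↑ˡ N) ≡ false) →
  ∀ k → cliques (m + N) P R (suc k)
      ≡ cliques N (P ∘ (m ↑ʳ_)) (R on (m ↑ʳ_)) (suc k)
        + ∑[ y < m ] (⟦ P (y ↑ˡ N) ⟧ * cliques N ((P ∩ R (y ↑ˡ N)) ∘ (m ↑ʳ_)) (R on (m ↑ʳ_)) k)
cliques-independent-↑ˡ zero    N P R indep k = sym (+-identityʳ _)
cliques-independent-↑ˡ (suc m) N P R indep k =
  trans (cong₂ _+_ (cong (⟦ P zero ⟧ *_) (cliques-drop-↑ˡ m N _ _ nbhd-zero k))
                   (cliques-independent-↑ˡ m N (P ∘ suc) (R on suc) (λ y y′ → indep (suc y) (suc y′)) k))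
        (x∙yz≈y∙xz (⟦ P zero ⟧ * cliques N ((P ∩ R zero) ∘ (suc m ↑ʳ_)) (R on (suc m ↑ʳ_)) k)
                   (cliques N (P ∘ (suc m ↑ʳ_)) (R on (suc m ↑ʳ_)) (suc k)) _)
  where
  nbhd-zero : ∀ y → (P ∩ R zero) (suc (y ↑ˡ N)) ≡ false
  nbhd-zero y = trans (cong (P (suc (y ↑ˡ N)) ∧_) (indep zero (suc y))) (∧-zeroʳ _)

-- Each (k+1)-clique is counted once for each of its vertices.
cliques-double-count : ∀ n (p : BoolPred n) R → Symmetricᵇ R → Irreflexiveᵇ R →
  ∀ k → ∑[ y < n ] (⟦ p y ⟧ * cliques n (p ∩ R y) R k) ≡ suc k * cliques n p R (suc k)
cliques-double-count zero    p R sym-R irr-R k    = sym (*-zeroʳ k)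
cliques-double-count (suc n) p R sym-R irr-R zero =
  trans (cong (⟦ p zero ⟧ * 1 +_)
              (cliques-double-count n (p ∘ suc) (R on suc)
                 (Symmetricᵇ-on R suc sym-R) (Irreflexiveᵇ-on R suc irr-R) zero))
        (regroup ⟦ p zero ⟧ (cliques n (p ∘ suc) (R on suc) 1))
  where
  regroup : ∀ a w → a * 1 + 1 * w ≡ 1 * (a * 1 + w)
  regroup = solve-∀
cliques-double-count (suc n) p R sym-R irr-R (suc k) = begin
  ⟦ p zero ⟧ * cliques (suc n) (p ∩ R zero) R (suc k)
    + ∑[ y < n ] (⟦ p′ y ⟧ * cliques (suc n) (p ∩ R (suc y)) R (suc k))
    ≡⟨ cong₂ _+_ (cong (⟦ p zero ⟧ *_) (cliques-drop-zero n (p ∩ R zero) R nbhd-zero (suc k)))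
                 (sum-cong-≗ split-at-zero) ⟩
  ⟦ p zero ⟧ * X + ∑[ y < n ] (⟦ p zero ⟧ * through-zero y + avoiding-zero y)
    ≡⟨ cong (⟦ p zero ⟧ * X +_) (trans (∑-distrib-+ (λ y → ⟦ p zero ⟧ * through-zero y) avoiding-zero)
         (cong (_+ sum avoiding-zero) (sym (*-distribˡ-sum ⟦ p zero ⟧ through-zero)))) ⟩
  ⟦ p zero ⟧ * X + (⟦ p zero ⟧ * sum through-zero + sum avoiding-zero)
    ≡⟨ cong (⟦ p zero ⟧ * X +_) (cong₂ _+_
         (cong (⟦ p zero ⟧ *_) (cliques-double-count n q R′ sym-R′ irr-R′ k))
         (cliques-double-count n p′ R′ sym-R′ irr-R′ (suc k))) ⟩
  ⟦ p zero ⟧ * X + (⟦ p zero ⟧ * (suc k * X) + suc (suc k) * W)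
    ≡⟨ regroup ⟦ p zero ⟧ X W k ⟩
  suc (suc k) * (⟦ p zero ⟧ * X + W) ∎
  where
  open ≡-Reasoning
  p′ q : BoolPred n
  p′ = p ∘ suc
  q  = (p ∩ R zero) ∘ suc
  R′ : BoolRel n
  R′ = R on suc
  sym-R′ : Symmetricᵇ R′
  sym-R′ = Symmetricᵇ-on R suc sym-R
  irr-R′ : Irreflexiveᵇ R′
  irr-R′ = Irreflexiveᵇ-on R suc irr-R
  X W : ℕ
  X = cliques n q R′ (suc k)
  W = cliques n p′ R′ (suc (suc k))
  through-zero avoiding-zero : Fin n → ℕ
  through-zero y  = ⟦ q y ⟧ * cliques n (q ∩ R′ y) R′ k
  avoiding-zero y = ⟦ p′ y ⟧ * cliques n (p′ ∩ R′ y) R′ (suc k)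
  nbhd-zero : (p ∩ R zero) zero ≡ false
  nbhd-zero = trans (cong (p zero ∧_) (irr-R zero)) (∧-zeroʳ _)
  distribute : ∀ a b r c w → a * (b * r * c + w) ≡ b * (a * r * c) + a * w
  distribute = solve-∀
  regroup : ∀ a x w k → a * x + (a * (suc k * x) + suc (suc k) * w) ≡ suc (suc k) * (a * x + w)
  regroup = solve-∀
  split-at-zero : ∀ y → ⟦ p′ y ⟧ * cliques (suc n) (p ∩ R (suc y)) R (suc k)
                      ≡ ⟦ p zero ⟧ * through-zero y + avoiding-zero y
  split-at-zero y = begin
    ⟦ p′ y ⟧ * (⟦ p zero ∧ R (suc y) zero ⟧ * cliques n (((p ∩ R (suc y)) ∩ R zero) ∘ suc) R′ k
               + cliques n (p′ ∩ R′ y) R′ (suc k))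
      ≡⟨ cong (λ t → ⟦ p′ y ⟧ * (t + cliques n (p′ ∩ R′ y) R′ (suc k)))
           (cong₂ _*_ (trans (cong (⟦_⟧ ∘ (p zero ∧_)) (sym-R (suc y) zero)) (⟦∧⟧ (p zero) _))
                      (cliques-cong n (λ z → ∧.xy∙z≈xz∙y (p′ z) (R′ y z) (R zero (suc z)))
                                      (λ _ _ → refl) k)) ⟩
    ⟦ p′ y ⟧ * (⟦ p zero ⟧ * ⟦ R zero (suc y) ⟧ * C + cliques n (p′ ∩ R′ y) R′ (suc k))
      ≡⟨ distribute ⟦ p′ y ⟧ ⟦ p zero ⟧ ⟦ R zero (suc y) ⟧ C (cliques n (p′ ∩ R′ y) R′ (suc k)) ⟩
    ⟦ p zero ⟧ * (⟦ p′ y ⟧ * ⟦ R zero (suc y) ⟧ * C) + avoiding-zero y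
      ≡⟨ cong (λ t → ⟦ p zero ⟧ * (t * C) + avoiding-zero y) (sym (⟦∧⟧ (p′ y) (R zero (suc y)))) ⟩
    ⟦ p zero ⟧ * through-zero y + avoiding-zero y ∎
    where
    C = cliques n (q ∩ R′ y) R′ k

remQuot-↑ˡ : ∀ {n} m (y : Fin m) → remQuot {suc n} m (y ↑ˡ (n * m)) ≡ (zero , y)
remQuot-↑ˡ m y = remQuot-combine zero y

remQuot-↑ʳ : ∀ {n} m (z : Fin (n * m)) →
  remQuot {suc n} m (m ↑ʳ z) ≡ (suc (quotient {n} m z) , remainder {n} m z)
remQuot-↑ʳ {n} m z rewrite splitAt-↑ʳ m (n * m) z = refl

infixr 7 _×ᵇ_ _⊗_
_×ᵇ_ : ∀ {n m} → BoolPred n → BoolPred m → BoolPred (n * m)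
_×ᵇ_ {n} {m} p q x = p (quotient m x) ∧ q (remainder {n} m x)

_⊗_ : ∀ {n m} → BoolRel n → BoolRel m → BoolRel (n * m)
_⊗_ {n} {m} R S x y = R (quotient m x) (quotient m y) ∧ S (remainder {n} m x) (remainder {n} m y)

×ᵇ-∩-⊗ : ∀ {n m} (p : BoolPred n) (q : BoolPred m) (R : BoolRel n) (S : BoolRel m) x →
  ((p ×ᵇ q) ∩ (R ⊗ S) x) ≗ ((p ∩ R (quotient m x)) ×ᵇ (q ∩ S (remainder {n} m x)))
×ᵇ-∩-⊗ p q R S x y = ∧.interchange (p _) (q _) (R _ _) (S _ _)

×ᵇ-↑ˡ : ∀ {n m} (p : BoolPred (suc n)) (q : BoolPred m) y → (p ×ᵇ q) (y ↑ˡ (n * m)) ≡ p zero ∧ q y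
×ᵇ-↑ˡ {m = m} p q y = cong (λ (a , b) → p a ∧ q b) (remQuot-↑ˡ m y)

⊗-↑ˡ : ∀ {n m} (R : BoolRel (suc n)) (S : BoolRel m) y y′ →
  (R ⊗ S) (y ↑ˡ (n * m)) (y′ ↑ˡ (n * m)) ≡ R zero zero ∧ S y y′
⊗-↑ˡ {m = m} R S y y′ = cong₂ (λ (a , b) (a′ , b′) → R a a′ ∧ S b b′) (remQuot-↑ˡ m y) (remQuot-↑ˡ m y′)

×ᵇ-↑ʳ : ∀ {n m} (p : BoolPred (suc n)) (q : BoolPred m) → ((p ×ᵇ q) ∘ (m ↑ʳ_)) ≗ ((p ∘ suc) ×ᵇ q)
×ᵇ-↑ʳ {m = m} p q z = cong (λ (a , b) → p a ∧ q b) (remQuot-↑ʳ m z)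

⊗-↑ʳ : ∀ {n m} (R : BoolRel (suc n)) (S : BoolRel m) z z′ →
  (R ⊗ S) (m ↑ʳ z) (m ↑ʳ z′) ≡ ((R on suc) ⊗ S) z z′
⊗-↑ʳ {m = m} R S z z′ = cong₂ (λ (a , b) (a′ , b′) → R a a′ ∧ S b b′) (remQuot-↑ʳ m z) (remQuot-↑ʳ m z′)

cliques-⊗-↑ʳ : ∀ n m (p : BoolPred (suc n)) (q : BoolPred m) (R : BoolRel (suc n)) (S : BoolRel m) k →
  cliques (n * m) ((p ×ᵇ q) ∘ (m ↑ʳ_)) ((R ⊗ S) on (m ↑ʳ_)) k
    ≡ cliques (n * m) ((p ∘ suc) ×ᵇ q) ((R on suc) ⊗ S) k
cliques-⊗-↑ʳ n m p q R S = cliques-cong (n * m) (×ᵇ-↑ʳ p q) (⊗-↑ʳ R S)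

cliques-⊗ : ∀ n m (p : BoolPred n) (R : BoolRel n) (q : BoolPred m) (S : BoolRel m) →
  Irreflexiveᵇ R → Symmetricᵇ S → Irreflexiveᵇ S →
  ∀ k → cliques (n * m) (p ×ᵇ q) (R ⊗ S) k ≡ k ! * cliques n p R k * cliques m q S k
cliques-⊗ n       m p R q S irr-R sym-S irr-S zero    = refl
cliques-⊗ zero    m p R q S irr-R sym-S irr-S (suc k) =
  sym (cong (_* cliques m q S (suc k)) (*-zeroʳ (suc k !)))
cliques-⊗ (suc n) m p R q S irr-R sym-S irr-S (suc k) = begin
  cliques (m + n * m) (p ×ᵇ q) (R ⊗ S) (suc k)
    ≡⟨ cliques-independent-↑ˡ m (n * m) (p ×ᵇ q) (R ⊗ S) first-block-independent k ⟩
  cliques (n * m) ((p ×ᵇ q) ∘ (m ↑ʳ_)) ((R ⊗ S) on (m ↑ʳ_)) (suc k) + ∑[ y < m ] through-first-block y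
    ≡⟨ cong₂ _+_ (trans (cliques-⊗-↑ʳ n m p q R S (suc k))
                        (cliques-⊗ n m p′ R′ q S irr-R′ sym-S irr-S (suc k)))
                 (sum-cong-≗ through-first-block≡) ⟩
  suc k ! * Y * Z + ∑[ y < m ] (⟦ p zero ⟧ * (k ! * X) * (⟦ q y ⟧ * cliques m (q ∩ S y) S k))
    ≡⟨ cong (suc k ! * Y * Z +_)
         (trans (sym (*-distribˡ-sum (⟦ p zero ⟧ * (k ! * X)) (λ y → ⟦ q y ⟧ * cliques m (q ∩ S y) S k)))
                (cong (⟦ p zero ⟧ * (k ! * X) *_) (cliques-double-count m q S sym-S irr-S k))) ⟩
  suc k ! * Y * Z + ⟦ p zero ⟧ * (k ! * X) * (suc k * Z)
    ≡⟨ regroup (k !) ⟦ p zero ⟧ X Y Z k ⟩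
  suc k ! * (⟦ p zero ⟧ * X + Y) * Z ∎
  where
  open ≡-Reasoning
  p′ : BoolPred n
  p′ = p ∘ suc
  R′ : BoolRel n
  R′ = R on suc
  irr-R′ : Irreflexiveᵇ R′
  irr-R′ = Irreflexiveᵇ-on R suc irr-R
  X Y Z : ℕ
  X = cliques n ((p ∩ R zero) ∘ suc) R′ k
  Y = cliques n p′ R′ (suc k)
  Z = cliques m q S (suc k)
  regroup : ∀ f a x y z k → suc k * f * y * z + a * (f * x) * (suc k * z) ≡ suc k * f * (a * x + y) * z
  regroup = solve-∀
  first-block-independent : ∀ y y′ → (R ⊗ S) (y ↑ˡ (n * m)) (y′ ↑ˡ (n * m)) ≡ false
  first-block-independent y y′ = trans (⊗-↑ˡ R S y y′) (cong (_∧ S y y′) (irr-R zero))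
  through-first-block : Fin m → ℕ
  through-first-block y = ⟦ (p ×ᵇ q) (y ↑ˡ (n * m)) ⟧
    * cliques (n * m) (((p ×ᵇ q) ∩ (R ⊗ S) (y ↑ˡ (n * m))) ∘ (m ↑ʳ_)) ((R ⊗ S) on (m ↑ʳ_)) k
  through-first-block≡ : ∀ y →
    through-first-block y ≡ ⟦ p zero ⟧ * (k ! * X) * (⟦ q y ⟧ * cliques m (q ∩ S y) S k)
  through-first-block≡ y = begin
    ⟦ (p ×ᵇ q) (y ↑ˡ (n * m)) ⟧
      * cliques (n * m) (((p ×ᵇ q) ∩ (R ⊗ S) (y ↑ˡ (n * m))) ∘ (m ↑ʳ_)) ((R ⊗ S) on (m ↑ʳ_)) k
      ≡⟨ cong₂ _*_ (trans (cong ⟦_⟧ (×ᵇ-↑ˡ p q y)) (⟦∧⟧ (p zero) (q y)))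
                   (cliques-cong (n * m) nbhd (λ _ _ → refl) k) ⟩
    ⟦ p zero ⟧ * ⟦ q y ⟧ * cliques (n * m) (((p ∩ R zero) ×ᵇ (q ∩ S y)) ∘ (m ↑ʳ_)) ((R ⊗ S) on (m ↑ʳ_)) k
      ≡⟨ cong (⟦ p zero ⟧ * ⟦ q y ⟧ *_) (trans (cliques-⊗-↑ʳ n m (p ∩ R zero) (q ∩ S y) R S k)
           (cliques-⊗ n m ((p ∩ R zero) ∘ suc) R′ (q ∩ S y) S irr-R′ sym-S irr-S k)) ⟩
    ⟦ p zero ⟧ * ⟦ q y ⟧ * (k ! * X * cliques m (q ∩ S y) S k)
      ≡⟨ interchange ⟦ p zero ⟧ ⟦ q y ⟧ (k ! * X) (cliques m (q ∩ S y) S k) ⟩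
    ⟦ p zero ⟧ * (k ! * X) * (⟦ q y ⟧ * cliques m (q ∩ S y) S k) ∎
    where
    nbhd : ((p ×ᵇ q) ∩ (R ⊗ S) (y ↑ˡ (n * m))) ∘ (m ↑ʳ_) ≗ ((p ∩ R zero) ×ᵇ (q ∩ S y)) ∘ (m ↑ʳ_)
    nbhd z = trans (×ᵇ-∩-⊗ p q R S (y ↑ˡ (n * m)) (m ↑ʳ z))
                   (cong (λ (a , b) → ((p ∩ R a) ×ᵇ (q ∩ S b)) (m ↑ʳ z)) (remQuot-↑ˡ m y))
    interchange : ∀ a b x c → a * b * (x * c) ≡ a * x * (b * c)
    interchange = solve-∀

count : ∀ {X : Set} → (X → Bool) → List X → ℕ
count f []       = 0
count f (x ∷ xs) = ⟦ f x ⟧ + count f xs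

length-filter≡count : ∀ {X : Set} (f : X → Bool) xs → length (filter (λ x → T? (f x)) xs) ≡ count f xs
length-filter≡count f []       = refl
length-filter≡count f (x ∷ xs) with f x
... | true  = cong suc (length-filter≡count f xs)
... | false = length-filter≡count f xs

count-++ : ∀ {X : Set} (f : X → Bool) xs ys → count f (xs ++ ys) ≡ count f xs + count f ys
count-++ f []       ys = refl
count-++ f (x ∷ xs) ys = trans (cong (⟦ f x ⟧ +_) (count-++ f xs ys)) (sym (+-assoc ⟦ f x ⟧ _ _))

count-map : ∀ {X Y : Set} (f : Y → Bool) (g : X → Y) xs → count f (map g xs) ≡ count (f ∘ g) xs
count-map f g []       = refl
count-map f g (x ∷ xs) = cong (⟦ f (g x) ⟧ +_) (count-map f g xs)

count-cong : ∀ {X : Set} {f g : X → Bool} → f ≗ g → ∀ xs → count f xs ≡ count g xs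
count-cong f≗g []       = refl
count-cong f≗g (x ∷ xs) = cong₂ _+_ (cong ⟦_⟧ (f≗g x)) (count-cong f≗g xs)

count-false : ∀ {X : Set} (xs : List X) → count (λ _ → false) xs ≡ 0
count-false []       = refl
count-false (x ∷ xs) = count-false xs

count-∧ˡ : ∀ {X : Set} b (f : X → Bool) xs → count (λ x → b ∧ f x) xs ≡ ⟦ b ⟧ * count f xs
count-∧ˡ false f xs = count-false xs
count-∧ˡ true  f xs = sym (+-identityʳ _)

count-allSubsets-suc : ∀ n (f : Subset (suc n) → Bool) →
  count f (allSubsets (suc n)) ≡ count (f ∘ (inside ∷_)) (allSubsets n) + count (f ∘ (outside ∷_)) (allSubsets n)
count-allSubsets-suc n f =
  trans (count-++ f (map (inside ∷_) (allSubsets n)) (map (outside ∷_) (allSubsets n)))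
        (cong₂ _+_ (count-map f (inside ∷_) (allSubsets n)) (count-map f (outside ∷_) (allSubsets n)))

T-injective : ∀ {a b} → T a ⇔ T b → a ≡ b
T-injective {true}  {true}  a⇔b = refl
T-injective {true}  {false} a⇔b = contradiction (Equivalence.to a⇔b tt) λ ()
T-injective {false} {true}  a⇔b = contradiction (Equivalence.from a⇔b tt) λ ()
T-injective {false} {false} a⇔b = refl

T-⇒ᵇ : ∀ {a b} → T (a ⇒ᵇ b) ⇔ (T a → T b)
T-⇒ᵇ {true}  = mk⇔ (λ t _ → t) (λ f → f tt)
T-⇒ᵇ {false} = mk⇔ (λ _ ()) (λ _ → tt)

T-all-tabulate : ∀ {X : Set} n (f : X → Bool) (g : Fin n → X) → T (all f (tabulate g)) ⇔ (∀ i → T (f (g i)))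
T-all-tabulate zero    f g = mk⇔ (λ _ ()) (λ _ → tt)
T-all-tabulate (suc n) f g = mk⇔ to from
  where
  to : T (all f (tabulate g)) → ∀ i → T (f (g i))
  to t zero    = proj₁ (Equivalence.to T-∧ t)
  to t (suc i) = Equivalence.to (T-all-tabulate n f (g ∘ suc)) (proj₂ (Equivalence.to T-∧ t)) i
  from : (∀ i → T (f (g i))) → T (all f (tabulate g))
  from h = Equivalence.from T-∧ (h zero , Equivalence.from (T-all-tabulate n f (g ∘ suc)) (h ∘ suc))

T-≢ : ∀ {n} (i j : Fin n) → T (not (does (i ≟ j))) ⇔ i ≢ j
T-≢ i j with i ≟ j
... | yes i≡j = mk⇔ (λ ()) (λ i≢j → i≢j i≡j)
... | no  i≢j = mk⇔ (λ _ → i≢j) (λ _ → tt)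

-- A k G w counts the subsets S with isCliqueInᵇ (adj G w) (adj G) k S.
isCliqueInᵇ : ∀ {n} → BoolPred n → BoolRel n → ℕ → Subset n → Bool
isCliqueInᵇ {n} p R k S =
  (∣ S ∣ ≡ᵇ k) ∧ all (λ i → lookup S i ⇒ᵇ p i) (allFin n)
  ∧ all (λ i → all (λ j → (lookup S i ∧ lookup S j ∧ not (does (i ≟ j))) ⇒ᵇ R i j) (allFin n)) (allFin n)

record IsCliqueIn {n} (p : BoolPred n) (R : BoolRel n) (k : ℕ) (S : Subset n) : Set where
  field
    size     : ∣ S ∣ ≡ k
    within   : ∀ i → T (lookup S i) → T (p i)
    adjacent : ∀ i j → T (lookup S i) → T (lookup S j) → i ≢ j → T (R i j)

T-isCliqueInᵇ : ∀ {n} (p : BoolPred n) (R : BoolRel n) k S → T (isCliqueInᵇ p R k S) ⇔ IsCliqueIn p R k S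
T-isCliqueInᵇ {n} p R k S = mk⇔ sound complete
  where
  open Equivalence using (to; from)
  T-all : (f : BoolPred n) → T (all f (allFin n)) ⇔ (∀ i → T (f i))
  T-all f = T-all-tabulate n f (λ i → i)
  member : BoolPred n
  member i = lookup S i ⇒ᵇ p i
  adjacent-pair : BoolRel n
  adjacent-pair i j = (lookup S i ∧ lookup S j ∧ not (does (i ≟ j))) ⇒ᵇ R i j
  adjacent-row : BoolPred n
  adjacent-row i = all (adjacent-pair i) (allFin n)
  sound : T (isCliqueInᵇ p R k S) → IsCliqueIn p R k S
  sound t =
    let (size , rest)         = to (T-∧ {∣ S ∣ ≡ᵇ k}) t
        (members , adjacents) = to (T-∧ {all member (allFin n)}) rest
    in record
    { size     = ≡ᵇ⇒≡ ∣ S ∣ k size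
    ; within   = λ i → to T-⇒ᵇ (to (T-all member) members i)
    ; adjacent = λ i j i∈S j∈S i≢j →
        to T-⇒ᵇ (to (T-all (adjacent-pair i)) (to (T-all adjacent-row) adjacents i) j)
                (from T-∧ (i∈S , from T-∧ (j∈S , from (T-≢ i j) i≢j)))
    }
  complete : IsCliqueIn p R k S → T (isCliqueInᵇ p R k S)
  complete c = from (T-∧ {∣ S ∣ ≡ᵇ k}) (≡⇒≡ᵇ ∣ S ∣ k size , from T-∧
    ( from (T-all member) (λ i → from T-⇒ᵇ (within i))
    , from (T-all adjacent-row) (λ i → from (T-all (adjacent-pair i)) (λ j → from T-⇒ᵇ λ t →
        let (i∈S , rest) = to (T-∧ {lookup S i}) t
            (j∈S , i≢j)  = to (T-∧ {lookup S j}) rest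
        in adjacent i j i∈S j∈S (to (T-≢ i j) i≢j)))))
    where open IsCliqueIn c

IsCliqueIn-outside : ∀ {n} (p : BoolPred (suc n)) (R : BoolRel (suc n)) k S →
  IsCliqueIn p R k (outside ∷ S) ⇔ IsCliqueIn (p ∘ suc) (R on suc) k S
IsCliqueIn-outside p R k S = mk⇔ restrict extend
  where
  restrict : IsCliqueIn p R k (outside ∷ S) → IsCliqueIn (p ∘ suc) (R on suc) k S
  restrict c = record
    { size     = size
    ; within   = within ∘ suc
    ; adjacent = λ i j i∈S j∈S i≢j → adjacent (suc i) (suc j) i∈S j∈S (i≢j ∘ Fin.suc-injective)
    }
    where open IsCliqueIn c
  extend : IsCliqueIn (p ∘ suc) (R on suc) k S → IsCliqueIn p R k (outside ∷ S)
  extend c = record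
    { size     = size
    ; within   = λ { zero () ; (suc i) → within i }
    ; adjacent = λ
      { zero    _       ()  _
      ; (suc i) zero    _   ()
      ; (suc i) (suc j) i∈S j∈S i≢j → adjacent i j i∈S j∈S (i≢j ∘ cong suc)
      }
    }
    where open IsCliqueIn c

IsCliqueIn-inside : ∀ {n} (p : BoolPred (suc n)) (R : BoolRel (suc n)) → Symmetricᵇ R → ∀ k S →
  IsCliqueIn p R (suc k) (inside ∷ S) ⇔ (T (p zero) × IsCliqueIn ((p ∩ R zero) ∘ suc) (R on suc) k S)
IsCliqueIn-inside p R sym-R k S = mk⇔ restrict extend
  where
  restrict : IsCliqueIn p R (suc k) (inside ∷ S) → T (p zero) × IsCliqueIn ((p ∩ R zero) ∘ suc) (R on suc) k S
  restrict c = within zero tt , record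
    { size     = suc-injective size
    ; within   = λ i i∈S → Equivalence.from T-∧ (within (suc i) i∈S , adjacent zero (suc i) tt i∈S λ ())
    ; adjacent = λ i j i∈S j∈S i≢j → adjacent (suc i) (suc j) i∈S j∈S (i≢j ∘ Fin.suc-injective)
    }
    where open IsCliqueIn c
  extend : T (p zero) × IsCliqueIn ((p ∩ R zero) ∘ suc) (R on suc) k S → IsCliqueIn p R (suc k) (inside ∷ S)
  extend (p₀ , c) = record
    { size     = cong suc size
    ; within   = λ { zero _ → p₀ ; (suc i) i∈S → proj₁ (in-nbhd i i∈S) }
    ; adjacent = λ
      { zero    zero    _   _   0≢0 → contradiction refl 0≢0
      ; zero    (suc j) _   j∈S _   → proj₂ (in-nbhd j j∈S)
      ; (suc i) zero    i∈S _   _   → subst T (sym-R zero (suc i)) (proj₂ (in-nbhd i i∈S))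
      ; (suc i) (suc j) i∈S j∈S i≢j → adjacent i j i∈S j∈S (i≢j ∘ cong suc)
      }
    }
    where
    open IsCliqueIn c
    in-nbhd : ∀ i → T (lookup S i) → T (p (suc i)) × T (R zero (suc i))
    in-nbhd i i∈S = Equivalence.to T-∧ (within i i∈S)

isCliqueInᵇ-outside : ∀ {n} (p : BoolPred (suc n)) (R : BoolRel (suc n)) k S →
  isCliqueInᵇ p R k (outside ∷ S) ≡ isCliqueInᵇ (p ∘ suc) (R on suc) k S
isCliqueInᵇ-outside p R k S = T-injective
  (⇔-sym (T-isCliqueInᵇ (p ∘ suc) (R on suc) k S)
    ⇔-∘ (IsCliqueIn-outside p R k S ⇔-∘ T-isCliqueInᵇ p R k (outside ∷ S)))

isCliqueInᵇ-inside : ∀ {n} (p : BoolPred (suc n)) (R : BoolRel (suc n)) → Symmetricᵇ R → ∀ k S →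
  isCliqueInᵇ p R (suc k) (inside ∷ S) ≡ p zero ∧ isCliqueInᵇ ((p ∩ R zero) ∘ suc) (R on suc) k S
isCliqueInᵇ-inside p R sym-R k S = T-injective
  (⇔-sym T-∧
    ⇔-∘ ((⇔-id _ ×-⇔ ⇔-sym (T-isCliqueInᵇ ((p ∩ R zero) ∘ suc) (R on suc) k S))
    ⇔-∘ (IsCliqueIn-inside p R sym-R k S ⇔-∘ T-isCliqueInᵇ p R (suc k) (inside ∷ S))))

count-isCliqueInᵇ : ∀ n (p : BoolPred n) (R : BoolRel n) → Symmetricᵇ R →
  ∀ k → count (isCliqueInᵇ p R k) (allSubsets n) ≡ cliques n p R k
count-isCliqueInᵇ zero    p R sym-R zero    = refl
count-isCliqueInᵇ zero    p R sym-R (suc k) = refl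
count-isCliqueInᵇ (suc n) p R sym-R k =
  trans (count-allSubsets-suc n (isCliqueInᵇ p R k)) (by-zero k)
  where
  Ss = allSubsets n
  avoiding-zero : ∀ k → count (isCliqueInᵇ p R k ∘ (outside ∷_)) Ss ≡ cliques n (p ∘ suc) (R on suc) k
  avoiding-zero k = trans (count-cong (isCliqueInᵇ-outside p R k) Ss)
                          (count-isCliqueInᵇ n (p ∘ suc) (R on suc) (Symmetricᵇ-on R suc sym-R) k)
  through-zero : ∀ k → count (isCliqueInᵇ p R (suc k) ∘ (inside ∷_)) Ss
                     ≡ ⟦ p zero ⟧ * cliques n ((p ∩ R zero) ∘ suc) (R on suc) k
  through-zero k =
    trans (count-cong (isCliqueInᵇ-inside p R sym-R k) Ss)
      (trans (count-∧ˡ (p zero) (isCliqueInᵇ ((p ∩ R zero) ∘ suc) (R on suc) k) Ss)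
        (cong (⟦ p zero ⟧ *_) (count-isCliqueInᵇ n ((p ∩ R zero) ∘ suc) (R on suc) (Symmetricᵇ-on R suc sym-R) k)))
  by-zero : ∀ k → count (isCliqueInᵇ p R k ∘ (inside ∷_)) Ss + count (isCliqueInᵇ p R k ∘ (outside ∷_)) Ss
                ≡ cliques (suc n) p R k
  by-zero zero    = cong₂ _+_ (count-false Ss) (avoiding-zero zero)
  by-zero (suc k) = cong₂ _+_ (through-zero k) (avoiding-zero (suc k))

A≡cliques : ∀ {n} k (G : Graph n) w → A k G w ≡ cliques n (adj G w) (adj G) k
A≡cliques {n} k G w =
  trans (length-filter≡count (isCliqueInᵇ (adj G w) (adj G) k) (allSubsets n))
        (count-isCliqueInᵇ n (adj G w) (adj G) (Graph.sym G) k)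

adj-tensor-pair : ∀ {n m} (G : Graph n) (H : Graph m) u v →
  adj (tensor G H) (pair u v) ≗ (adj G u ×ᵇ adj H v)
adj-tensor-pair {n} {m} G H u v x =
  cong (λ (a , b) → adj G a (quotient m x) ∧ adj H b (remainder {n} m x)) (remQuot-combine u v)

proposition4p1 : ∀ {n m} (G : Graph n) (H : Graph m) (u₁ : Fin n) (v₁ : Fin m) (k : ℕ) →
    A (suc k) (tensor G H) (pair u₁ v₁) ≡ (suc k) ! * A (suc k) G u₁ * A (suc k) H v₁
proposition4p1 {n} {m} G H u₁ v₁ k = begin
  A (suc k) (tensor G H) (pair u₁ v₁)
    ≡⟨ A≡cliques (suc k) (tensor G H) (pair u₁ v₁) ⟩
  cliques (n * m) (adj (tensor G H) (pair u₁ v₁)) (adj G ⊗ adj H) (suc k)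
    ≡⟨ cliques-cong (n * m) (adj-tensor-pair G H u₁ v₁) (λ _ _ → refl) (suc k) ⟩
  cliques (n * m) (adj G u₁ ×ᵇ adj H v₁) (adj G ⊗ adj H) (suc k)
    ≡⟨ cliques-⊗ n m (adj G u₁) (adj G) (adj H v₁) (adj H) (irrefl G) (Graph.sym H) (irrefl H) (suc k) ⟩
  suc k ! * cliques n (adj G u₁) (adj G) (suc k) * cliques m (adj H v₁) (adj H) (suc k)
    ≡⟨ cong₂ (λ a b → suc k ! * a * b) (A≡cliques (suc k) G u₁) (A≡cliques (suc k) H v₁) ⟨
  suc k ! * A (suc k) G u₁ * A (suc k) H v₁ ∎
  where open ≡-Reasoning
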